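{- Let $G$ be a graph with $n$ vertices and layered treewidth $c\ge 1$. Then $G$ has a tree-decomposition $\mathcal{D}$ of width at most $2\sqrt{cn}$ such that, for every positive integer $k$, the subgraph of $G$ induced by the union of any $k$ bags of $\mathcal{D}$ has treewidth at most $(3k+1)c-1$.
   Context: A layering of $G$ is an ordered partition $(V_1,\dots,V_m)$ of $V(G)$ into (possibly empty) sets such that every edge has both endpoints in $V_i\cup V_{i+1}$ for some $i$. The layered treewidth $\operatorname{ltw}(G)$ is the minimum $\ell\ge0$ such that $G$ has a tree-decomposition $(X_x:x\in V(T))$ and a layering $(V_1,\dots,V_m)$ with $|X_x\cap V_i|\le\ell$ for every bag $X_x$ and layer $V_i$. -}

module Defs where

open import Data.Nat using (ℕ; zero; suc; _≤_; _<_; _+_; _*_; _∸_; _^_)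
open import Data.Nat.Properties using (_≟_)
open import Data.Bool using (if_then_else_)
open import Data.Fin using (Fin; zero; suc; toℕ)
open import Data.Fin.Subset using (Subset; _∈_; _⊆_; _∩_; ⋃; ∣_∣; inside; outside)
import Data.Fin.Subset as Sub
open import Data.Vec using (tabulate)
open import Data.List using (List; map; allFin)
open import Data.Product using (Σ; ∃; _×_; _,_)
open import Data.Sum using (_⊎_)
open import Relation.Nullary using (¬_; does)
open import Relation.Binary.PropositionalEquality using (_≡_)

record Graph (n : ℕ) : Set₁ where
  field
    Adj    : Fin n → Fin n → Set
    symm   : ∀ {u v} → Adj u v → Adj v u
    irrefl : ∀ {v} → ¬ Adj v v

open Graph public

-- A (nonempty, finite) tree on node set Fin (suc size), given by parent
-- pointers: node (suc i) is joined to (parent i), whose index is ≤ i.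
-- Every finite tree is isomorphic to one of this form (label nodes in BFS order).
record Tree : Set where
  field
    size    : ℕ
    parent  : Fin size → Fin (suc size)
    parent≤ : ∀ i → toℕ (parent i) ≤ toℕ i

open Tree public

Node : Tree → Set
Node T = Fin (suc (size T))

TAdj : (T : Tree) → Node T → Node T → Set
TAdj T x y = (∃ λ i → x ≡ suc i × y ≡ parent T i) ⊎ (∃ λ i → y ≡ suc i × x ≡ parent T i)

data WalkIn (T : Tree) (S : Node T → Set) : Node T → Node T → Set where
  here : ∀ {x} → S x → WalkIn T S x x
  step : ∀ {x y z} → S x → TAdj T x y → WalkIn T S y z → WalkIn T S x z

ConnectedIn : (T : Tree) → (Node T → Set) → Set
ConnectedIn T S = ∀ x y → S x → S y → WalkIn T S x y

-- Tree-decomposition of the induced subgraph G[U] (U ⊆ V(G)).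
-- For U = ⊤ this is an ordinary tree-decomposition of G.
record TreeDecomposition {n : ℕ} (G : Graph n) (U : Subset n) : Set where
  field
    tree  : Tree
    bag   : Node tree → Subset n
    bag⊆  : ∀ x → bag x ⊆ U
    cover : ∀ v → v ∈ U → ∃ λ x → v ∈ bag x
    edge  : ∀ u v → u ∈ U → v ∈ U → Adj G u v → ∃ λ x → u ∈ bag x × v ∈ bag x
    conn  : ∀ v → v ∈ U → ConnectedIn tree (λ x → v ∈ bag x)

open TreeDecomposition public

WidthAtMost : ∀ {n} {G : Graph n} {U : Subset n} → TreeDecomposition G U → ℕ → Set
WidthAtMost D w = ∀ x → ∣ bag D x ∣ ≤ suc w

TreewidthAtMost : ∀ {n} → Graph n → Subset n → ℕ → Set
TreewidthAtMost G U w = Σ (TreeDecomposition G U) λ D → WidthAtMost D w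

record Layering {n : ℕ} (G : Graph n) : Set where
  field
    layer   : Fin n → ℕ
    layerOk : ∀ u v → Adj G u v → layer u ≤ suc (layer v) × layer v ≤ suc (layer u)

open Layering public

layerSet : ∀ {n} {G : Graph n} → Layering G → ℕ → Subset n
layerSet L i = tabulate (λ v → if does (layer L v ≟ i) then inside else outside)

HasLayeredTW : ∀ {n} → Graph n → ℕ → Set
HasLayeredTW G ℓ =
  Σ (TreeDecomposition G Sub.⊤) λ D → Σ (Layering G) λ L →
    ∀ x i → ∣ bag D x ∩ layerSet L i ∣ ≤ ℓ

LayeredTWIs : ∀ {n} → Graph n → ℕ → Set
LayeredTWIs G c = HasLayeredTW G c × (∀ ℓ → ℓ < c → ¬ HasLayeredTW G ℓ)

unionBags : ∀ {n} {G : Graph n} {U : Subset n} (D : TreeDecomposition G U)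
            {k : ℕ} → (Fin k → Node (tree D)) → Subset n
unionBags D {k} f = ⋃ (map (λ j → bag D (f j)) (allFin k))

{-# OPTIONS --safe #-}

-- Let D₀ and L witness ltw(G) ≤ c, and let t be least with n ≤ (t + 1)²c. Every vertex lies on a
-- separator layer, i.e. a layer l with l + r ≡ 0 (mod t + 1), for exactly one r < t + 1, so for some
-- r the separator layers hold at most n / (t + 1) vertices. Between consecutive separator layers lie
-- windows of t layers, and no edge joins two windows. Chaining one copy of D₀ per window at the
-- roots, its bags cut down to the window and enlarged by all separator vertices, gives a
-- tree-decomposition D with bags of size at most n / (t + 1) + tc, whose square is at most 4cn by
-- the minimality of t.
--
-- For k bags of D with union U, every non-separator vertex of U lies in one of the corresponding k
-- bags of D₀, so each layer holds at most kc of them. Chaining one copy of D₀ per layer j, whose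
-- bags hold the separator vertices of U in layer j of the bag of D₀ together with all non-separator
-- vertices of U in layers j - 1, j and j + 1, decomposes G[U] with bags of size at most c + 3kc.
-- This needs separator layers to be pairwise non-adjacent, that is t ≥ 1; for t = 0 we have n ≤ c
-- and a single bag suffices.

module Submission where

open import Defs
open import Data.Nat
  using (ℕ; zero; suc; _≤_; _<_; _+_; _*_; _∸_; _^_; _⊔_; z≤n; s≤s; NonZero; >-nonZero; _≟_; _≤?_)
open import Data.Nat.Properties
  using (module ≤-Reasoning; +-0-commutativeMonoid; ≤-refl; ≤-reflexive; ≤-trans; ≤-antisym; ≤-pred; ≤-<-trans;
         <⇒≤; <⇒≱; ≰⇒>; ≤∧≢⇒<; <-cmp; n≮0; n≤1+n; m≤m+n; m≤n+m; m≤m*n; m≤m⊔n; m≤n⊔m;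
         +-comm; +-assoc; +-suc; +-identityʳ; *-identityˡ; *-identityʳ;
         +-mono-≤; +-monoˡ-≤; +-monoʳ-≤; +-monoˡ-<; *-mono-≤; *-monoʳ-≤;
         +-cancelʳ-≡; +-cancelʳ-≤; +-cancelˡ-<; *-cancelˡ-≤;
         m∸n≤m; ∸-monoˡ-≤; m≤n+m∸n; m+[n∸m]≡n; m+n∸n≡m; m<n⇒0<n∸m)
open import Data.Nat.DivMod
  using (_%_; _/_; m≡m%n+[m/n]*n; m%n<n; n%n≡0; n%1≡0; %-distribˡ-+; +-distrib-/; m<n⇒m/n≡0; m/n≤m)
open import Data.Nat.Divisibility using (_∣_; m%n≡0⇒n∣m; ∣m+n∣m⇒∣n; ∣⇒≤)
open import Data.Nat.Tactic.RingSolver using (solve)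
open import Algebra.Properties.CommutativeMonoid.Sum +-0-commutativeMonoid
  using (sum-syntax; ∑-comm; sum-cong-≗; sum-replicate-zero)
open import Data.Bool using (if_then_else_)
open import Data.Fin using (Fin; zero; suc; toℕ; fromℕ<; _↑ˡ_; _↑ʳ_; splitAt)
open import Data.Fin.Properties
  using (suc-injective; 0≢1+n; toℕ<n; toℕ-injective; toℕ-fromℕ<; toℕ-↑ˡ; toℕ-↑ʳ;
         splitAt-↑ˡ; splitAt-↑ʳ; splitAt⁻¹-↑ˡ; splitAt⁻¹-↑ʳ)
open import Data.Fin.Subset using (Subset; _∈_; _∉_; _⊆_; _∩_; _∪_; ⋃; ∣_∣; inside; outside)
import Data.Fin.Subset as Sub
open import Data.Fin.Subset.Properties
  using (_∈?_; ∈⊤; ∉⊥; x∈p∪q⁺; x∈p∪q⁻; x∈p∩q⁺; ∣⊥∣≡0; ∣p∣≤n; p⊆q⇒∣p∣≤∣q∣)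
open import Data.List using (List; []; _∷_; length; tabulate; allFin)
open import Data.List.Properties using (length-tabulate)
open import Data.List.Relation.Unary.All as All using (All)
import Data.List.Relation.Unary.All.Properties as Allₚ
open import Data.List.Relation.Unary.Any as Any using (Any; here; there)
import Data.List.Relation.Unary.Any.Properties as Anyₚ
import Data.Vec as Vec
open import Data.Vec.Properties using (lookup∘tabulate; []=⇒lookup; lookup⇒[]=)
open import Data.Product using (Σ; ∃; ∃₂; _×_; _,_; proj₁; proj₂)
open import Data.Sum using (_⊎_; inj₁; inj₂; [_,_]′)
open import Data.Empty using (⊥-elim)
open import Function using (_∘_; _⇔_; Equivalence; mk⇔)
open import Function.Definitions using (Injective)
open import Relation.Nullary using (¬_; Dec; yes; no; does; contradiction)
open import Relation.Nullary.Decidable using (¬?; _×-dec_)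
open import Relation.Unary using (Decidable)
open import Relation.Binary.Definitions using (tri<; tri≈; tri>)
open import Relation.Binary.PropositionalEquality
  using (_≡_; _≢_; refl; sym; trans; cong; subst; module ≡-Reasoning)

open Equivalence using (to; from)

-- Walks in trees

module _ {T : Tree} where

  TAdj-sym : ∀ {x y} → TAdj T x y → TAdj T y x
  TAdj-sym (inj₁ e) = inj₂ e
  TAdj-sym (inj₂ e) = inj₁ e

  module _ {S : Node T → Set} where

    walk-head : ∀ {x y} → WalkIn T S x y → S x
    walk-head (here s)     = s
    walk-head (step s _ _) = s

    _++ʷ_ : ∀ {x y z} → WalkIn T S x y → WalkIn T S y z → WalkIn T S x z
    here _     ++ʷ w′ = w′
    step s a w ++ʷ w′ = step s a (w ++ʷ w′)

    reverseʷ : ∀ {x y} → WalkIn T S x y → WalkIn T S y x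
    reverseʷ (here s)     = here s
    reverseʷ (step s a w) = reverseʷ w ++ʷ step (walk-head w) (TAdj-sym a) (here s)

    connectedIn-empty : (∀ z → ¬ S z) → ConnectedIn T S
    connectedIn-empty absent x _ sx _ = ⊥-elim (absent x sx)

    walk-to-root : (∀ z → S z) → ∀ k x → toℕ x ≤ k → WalkIn T S x zero
    walk-to-root all _       zero    _         = here (all zero)
    walk-to-root all (suc k) (suc i) (s≤s i≤k) =
      step (all (suc i)) (inj₁ (i , refl , refl))
           (walk-to-root all k (parent T i) (≤-trans (parent≤ T i) i≤k))

    connectedIn-all : (∀ z → S z) → ConnectedIn T S
    connectedIn-all all x y _ _ =
      walk-to-root all (toℕ x) x ≤-refl ++ʷ reverseʷ (walk-to-root all (toℕ y) y ≤-refl)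

  connectedIn-resp : ∀ {S S′ : Node T → Set} → (∀ {z} → S z → S′ z) → (∀ {z} → S′ z → S z) →
                     ConnectedIn T S → ConnectedIn T S′
  connectedIn-resp {S} {S′} to′ from′ conn x y sx sy = weaken (conn x y (from′ sx) (from′ sy))
    where
    weaken : ∀ {x y} → WalkIn T S x y → WalkIn T S′ x y
    weaken (here s)     = here (to′ s)
    weaken (step s a w) = step (to′ s) a (weaken w)

mapʷ : ∀ {T T′ : Tree} {S : Node T → Set} {S′ : Node T′ → Set} (f : Node T → Node T′) →
       (∀ {x y} → TAdj T x y → TAdj T′ (f x) (f y)) → (∀ {x} → S x → S′ (f x)) →
       ∀ {x y} → WalkIn T S x y → WalkIn T′ S′ (f x) (f y)
mapʷ f adj sf (here s)     = here (sf s)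
mapʷ f adj sf (step s a w) = step (sf s) (adj a) (mapʷ f adj sf w)

-- Gluing trees at their roots

-- The root of T₂ becomes a child of the root of T₁; the nodes of T₂ are numbered after those of T₁.
glue-parent : (T₁ T₂ : Tree) → Fin (size T₁ + suc (size T₂)) → Fin (suc (size T₁ + suc (size T₂)))
glue-parent T₁ T₂ i with splitAt (size T₁) i
... | inj₁ j       = parent T₁ j ↑ˡ suc (size T₂)
... | inj₂ zero    = zero
... | inj₂ (suc j) = suc (size T₁) ↑ʳ parent T₂ j

glue-parent≤ : (T₁ T₂ : Tree) → ∀ i → toℕ (glue-parent T₁ T₂ i) ≤ toℕ i
glue-parent≤ T₁ T₂ i with splitAt (size T₁) i in eq
... | inj₁ j rewrite sym (splitAt⁻¹-↑ˡ eq)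
                   | toℕ-↑ˡ (parent T₁ j) (suc (size T₂)) | toℕ-↑ˡ j (suc (size T₂)) = parent≤ T₁ j
... | inj₂ zero = z≤n
... | inj₂ (suc j) rewrite sym (splitAt⁻¹-↑ʳ eq)
                         | toℕ-↑ʳ (suc (size T₁)) (parent T₂ j) | toℕ-↑ʳ (size T₁) (suc j)
                         | +-suc (size T₁) (toℕ j) = s≤s (+-monoʳ-≤ (size T₁) (parent≤ T₂ j))

Glue : Tree → Tree → Tree
Glue T₁ T₂ = record { size = size T₁ + suc (size T₂) ; parent = glue-parent T₁ T₂ ; parent≤ = glue-parent≤ T₁ T₂ }

module Glued (T₁ T₂ : Tree) where

  private
    s₁ s₂ : ℕ
    s₁ = size T₁
    s₂ = size T₂

  left : Node T₁ → Node (Glue T₁ T₂)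
  left x = x ↑ˡ suc s₂

  right : Node T₂ → Node (Glue T₁ T₂)
  right y = suc s₁ ↑ʳ y

  split : ∀ z → (∃ λ x → z ≡ left x) ⊎ (∃ λ y → z ≡ right y)
  split z with splitAt (suc s₁) z in eq
  ... | inj₁ x = inj₁ (x , sym (splitAt⁻¹-↑ˡ eq))
  ... | inj₂ y = inj₂ (y , sym (splitAt⁻¹-↑ʳ eq))

  private
    parent-left : ∀ i → left (parent T₁ i) ≡ glue-parent T₁ T₂ (i ↑ˡ suc s₂)
    parent-left i rewrite splitAt-↑ˡ s₁ i (suc s₂) = refl

    parent-right : ∀ i → right (parent T₂ i) ≡ glue-parent T₁ T₂ (s₁ ↑ʳ suc i)
    parent-right i rewrite splitAt-↑ʳ s₁ (suc s₂) (suc i) = refl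

    parent-root : left zero ≡ glue-parent T₁ T₂ (s₁ ↑ʳ zero)
    parent-root rewrite splitAt-↑ʳ s₁ (suc s₂) zero = refl

  adj-left : ∀ {x x′} → TAdj T₁ x x′ → TAdj (Glue T₁ T₂) (left x) (left x′)
  adj-left (inj₁ (i , refl , refl)) = inj₁ (i ↑ˡ suc s₂ , refl , parent-left i)
  adj-left (inj₂ (i , refl , refl)) = inj₂ (i ↑ˡ suc s₂ , refl , parent-left i)

  adj-right : ∀ {y y′} → TAdj T₂ y y′ → TAdj (Glue T₁ T₂) (right y) (right y′)
  adj-right (inj₁ (i , refl , refl)) = inj₁ (s₁ ↑ʳ suc i , refl , parent-right i)
  adj-right (inj₂ (i , refl , refl)) = inj₂ (s₁ ↑ʳ suc i , refl , parent-right i)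

  adj-roots : TAdj (Glue T₁ T₂) (left zero) (right zero)
  adj-roots = inj₂ (s₁ ↑ʳ zero , refl , parent-root)

  module _ {n : ℕ} (B₁ : Node T₁ → Subset n) (B₂ : Node T₂ → Subset n) where

    glueBag : Node (Glue T₁ T₂) → Subset n
    glueBag z = [ B₁ , B₂ ]′ (splitAt (suc s₁) z)

    glueBag-left : ∀ x → glueBag (left x) ≡ B₁ x
    glueBag-left x rewrite splitAt-↑ˡ (suc s₁) x (suc s₂) = refl

    glueBag-right : ∀ y → glueBag (right y) ≡ B₂ y
    glueBag-right y rewrite splitAt-↑ʳ (suc s₁) (suc s₂) y = refl

    module _ {v : Fin n} where

      Tie : Set
      Tie = (∀ x → v ∉ B₁ x) ⊎ (∀ y → v ∉ B₂ y) ⊎ (v ∈ B₁ zero × v ∈ B₂ zero)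

      private
        S : Node (Glue T₁ T₂) → Set
        S z = v ∈ glueBag z

        inB₁ : ∀ {x} → S (left x) → v ∈ B₁ x
        inB₁ {x} = subst (v ∈_) (glueBag-left x)

        inB₂ : ∀ {y} → S (right y) → v ∈ B₂ y
        inB₂ {y} = subst (v ∈_) (glueBag-right y)

        walk-left : ∀ {x x′} → WalkIn T₁ (λ x → v ∈ B₁ x) x x′ → WalkIn (Glue T₁ T₂) S (left x) (left x′)
        walk-left = mapʷ left adj-left (λ {x} → subst (v ∈_) (sym (glueBag-left x)))

        walk-right : ∀ {y y′} → WalkIn T₂ (λ y → v ∈ B₂ y) y y′ → WalkIn (Glue T₁ T₂) S (right y) (right y′)
        walk-right = mapʷ right adj-right (λ {y} → subst (v ∈_) (sym (glueBag-right y)))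

        crossing : ConnectedIn T₁ (λ x → v ∈ B₁ x) → ConnectedIn T₂ (λ y → v ∈ B₂ y) → Tie →
                   ∀ {x y} → v ∈ B₁ x → v ∈ B₂ y → WalkIn (Glue T₁ T₂) S (left x) (right y)
        crossing _ _ (inj₁ absent) {x} h₁ _ = ⊥-elim (absent x h₁)
        crossing _ _ (inj₂ (inj₁ absent)) {y = y} _ h₂ = ⊥-elim (absent y h₂)
        crossing conn₁ conn₂ (inj₂ (inj₂ (r₁ , r₂))) {x} {y} h₁ h₂ =
          walk-left (conn₁ x zero h₁ r₁) ++ʷ
          step (subst (v ∈_) (sym (glueBag-left zero)) r₁) adj-roots (walk-right (conn₂ zero y r₂ h₂))

      glueBag-connected : ConnectedIn T₁ (λ x → v ∈ B₁ x) → ConnectedIn T₂ (λ y → v ∈ B₂ y) → Tie →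
                          ConnectedIn (Glue T₁ T₂) (λ z → v ∈ glueBag z)
      glueBag-connected conn₁ conn₂ tie z z′ hz hz′ with split z | split z′
      ... | inj₁ (x , refl) | inj₁ (x′ , refl) = walk-left (conn₁ x x′ (inB₁ hz) (inB₁ hz′))
      ... | inj₂ (y , refl) | inj₂ (y′ , refl) = walk-right (conn₂ y y′ (inB₂ hz) (inB₂ hz′))
      ... | inj₁ (x , refl) | inj₂ (y , refl)  = crossing conn₁ conn₂ tie (inB₁ hz) (inB₂ hz′)
      ... | inj₂ (y , refl) | inj₁ (x , refl)  = reverseʷ (crossing conn₁ conn₂ tie (inB₁ hz′) (inB₂ hz))

-- m + 1 copies of T whose roots form a path.
Chain : Tree → ℕ → Tree
Chain T zero    = T
Chain T (suc m) = Glue T (Chain T m)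

module _ {n : ℕ} (T : Tree) where

  private
    module Step (m : ℕ) = Glued T (Chain T m)

  chainBag : ∀ m → (Fin (suc m) → Node T → Subset n) → Node (Chain T m) → Subset n
  chainBag zero    B = B zero
  chainBag (suc m) B = Step.glueBag m (B zero) (chainBag m (B ∘ suc))

  chainBag-form : ∀ m B z → ∃₂ λ j x → chainBag m B z ≡ B j x
  chainBag-form zero    B z = zero , z , refl
  chainBag-form (suc m) B z with Step.split m z
  ... | inj₁ (x , refl) = zero , x , Step.glueBag-left m (B zero) (chainBag m (B ∘ suc)) x
  ... | inj₂ (y , refl) with chainBag-form m (B ∘ suc) y
  ...   | j , x , e = suc j , x , trans (Step.glueBag-right m (B zero) (chainBag m (B ∘ suc)) y) e

  chainBag-find : ∀ m B j x → ∃ λ z → chainBag m B z ≡ B j x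
  chainBag-find zero    B zero    x = x , refl
  chainBag-find (suc m) B zero    x = Step.left m x , Step.glueBag-left m (B zero) (chainBag m (B ∘ suc)) x
  chainBag-find (suc m) B (suc j) x with chainBag-find m (B ∘ suc) j x
  ... | z , e = Step.right m z , trans (Step.glueBag-right m (B zero) (chainBag m (B ∘ suc)) z) e

  chainBag-root : ∀ m B → chainBag m B zero ≡ B zero zero
  chainBag-root zero    B = refl
  chainBag-root (suc m) B = Step.glueBag-left m (B zero) (chainBag m (B ∘ suc)) zero

  chainBag-absent : ∀ m B {v} → (∀ j x → v ∉ B j x) → ∀ z → v ∉ chainBag m B z
  chainBag-absent m B {v} absent z h with chainBag-form m B z
  ... | j , x , e = absent j x (subst (v ∈_) e h)

  OneCopy : ∀ m → (Fin (suc m) → Node T → Subset n) → Fin n → Set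
  OneCopy m B v = ∃ λ j → (∀ j′ x → v ∈ B j′ x → j′ ≡ j) × ConnectedIn T (λ x → v ∈ B j x)

  CopyRange : ∀ m → (Fin (suc m) → Node T → Subset n) → Fin n → Set
  CopyRange m B v = ∃₂ λ a b → ∀ j x → v ∈ B j x ⇔ (a ≤ toℕ j × toℕ j ≤ b)

  copyRange-connected : ∀ {m B v} → CopyRange m B v → ∀ j → ConnectedIn T (λ x → v ∈ B j x)
  copyRange-connected (_ , _ , range) j x y hx =
    connectedIn-all (λ z → from (range j z) (to (range j x) hx)) x y hx

  range-tail : ∀ {m} (B : Fin (suc (suc m)) → Node T → Subset n) {v} a b →
               (∀ j x → v ∈ B j x ⇔ (a ≤ toℕ j × toℕ j ≤ suc b)) →
               ∀ j x → v ∈ B (suc j) x ⇔ (a ∸ 1 ≤ toℕ j × toℕ j ≤ b)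
  range-tail B zero    b bounds j x =
    mk⇔ (λ h → z≤n , ≤-pred (proj₂ (to (bounds (suc j) x) h)))
        (λ (_ , q) → from (bounds (suc j) x) (z≤n , s≤s q))
  range-tail B (suc a) b bounds j x =
    mk⇔ (λ h → let p , q = to (bounds (suc j) x) h in ≤-pred p , ≤-pred q)
        (λ (p , q) → from (bounds (suc j) x) (s≤s p , s≤s q))

  -- In the range case the bags of v are linked through the roots of consecutive copies.
  chainBag-connected : ∀ m B v → OneCopy m B v ⊎ CopyRange m B v →
                       ConnectedIn (Chain T m) (λ z → v ∈ chainBag m B z)
  chainBag-connected zero B v (inj₁ (zero , _ , conn)) = conn
  chainBag-connected zero B v (inj₂ range)             = copyRange-connected range zero
  chainBag-connected (suc m) B v (inj₁ (zero , only , conn)) =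
    Step.glueBag-connected m _ _ conn (connectedIn-empty absentʳ) (inj₂ (inj₁ absentʳ))
    where
    absentʳ : ∀ z → v ∉ chainBag m (B ∘ suc) z
    absentʳ = chainBag-absent m (B ∘ suc) (λ j x h → 0≢1+n (sym (only (suc j) x h)))
  chainBag-connected (suc m) B v (inj₁ (suc j , only , conn)) =
    Step.glueBag-connected m _ _ (connectedIn-empty absentˡ)
      (chainBag-connected m (B ∘ suc) v (inj₁ (j , (λ j′ x h → suc-injective (only (suc j′) x h)) , conn)))
      (inj₁ absentˡ)
    where
    absentˡ : ∀ x → v ∉ B zero x
    absentˡ x h = 0≢1+n (only zero x h)
  chainBag-connected (suc m) B v (inj₂ range@(_ , zero , bounds)) =
    Step.glueBag-connected m _ _ (copyRange-connected range zero) (connectedIn-empty absentʳ) (inj₂ (inj₁ absentʳ))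
    where
    absentʳ : ∀ z → v ∉ chainBag m (B ∘ suc) z
    absentʳ = chainBag-absent m (B ∘ suc) (λ j x h → n≮0 (proj₂ (to (bounds (suc j) x) h)))
  chainBag-connected (suc m) B v (inj₂ (suc a , suc b , bounds)) =
    Step.glueBag-connected m _ _ (connectedIn-empty absentˡ)
      (chainBag-connected m (B ∘ suc) v (inj₂ (a , b , range-tail B (suc a) b bounds))) (inj₁ absentˡ)
    where
    absentˡ : ∀ x → v ∉ B zero x
    absentˡ x h = n≮0 (proj₁ (to (bounds zero x) h))
  chainBag-connected (suc m) B v (inj₂ range@(zero , suc b , bounds)) =
    Step.glueBag-connected m _ _ (copyRange-connected range zero)
      (chainBag-connected m (B ∘ suc) v (inj₂ (zero , b , range-tail B zero b bounds)))
      (inj₂ (inj₂ (from (bounds zero zero) (z≤n , z≤n) ,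
                   subst (v ∈_) (sym (chainBag-root m (B ∘ suc)))
                         (from (bounds (suc zero) zero) (z≤n , s≤s z≤n)))))

module _ {n : ℕ} {G : Graph n} {U : Subset n} (T : Tree) (m : ℕ) (B : Fin (suc m) → Node T → Subset n) where

  chainDecomposition :
    (∀ j x → B j x ⊆ U) →
    (∀ v → v ∈ U → ∃₂ λ j x → v ∈ B j x) →
    (∀ u v → u ∈ U → v ∈ U → Adj G u v → ∃₂ λ j x → u ∈ B j x × v ∈ B j x) →
    (∀ v → v ∈ U → OneCopy T m B v ⊎ CopyRange T m B v) →
    Σ (TreeDecomposition G U) λ D → ∀ z → ∃₂ λ j x → bag D z ≡ B j x
  chainDecomposition B⊆U covers joins spans = D , chainBag-form T m B
    where
    D : TreeDecomposition G U
    D = record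
      { tree  = Chain T m
      ; bag   = chainBag T m B
      ; bag⊆  = λ z → let j , x , e = chainBag-form T m B z in subst (_⊆ U) (sym e) (B⊆U j x)
      ; cover = λ v hv → let j , x , h = covers v hv
                             z , e     = chainBag-find T m B j x
                         in z , subst (v ∈_) (sym e) h
      ; edge  = λ u v hu hv a → let j , x , h , h′ = joins u v hu hv a
                                    z , e          = chainBag-find T m B j x
                                in z , subst (u ∈_) (sym e) h , subst (v ∈_) (sym e) h′
      ; conn  = λ v hv → chainBag-connected T m B v (spans v hv)
      }

-- Counting in finite subsets

toSubset : ∀ {n} {P : Fin n → Set} → Decidable P → Subset n
toSubset P? = Vec.tabulate (λ v → if does (P? v) then inside else outside)

module _ {n} {P : Fin n → Set} (P? : Decidable P) where

  ∈-toSubset⁺ : ∀ {v} → P v → v ∈ toSubset P?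
  ∈-toSubset⁺ {v} p = lookup⇒[]= v _ (trans (lookup∘tabulate _ v) (inside-if (P? v) p))
    where
    inside-if : ∀ {A : Set} (a? : Dec A) → A → (if does a? then inside else outside) ≡ inside
    inside-if (yes _) _ = refl
    inside-if (no ¬a) a = contradiction a ¬a

  ∈-toSubset⁻ : ∀ {v} → v ∈ toSubset P? → P v
  ∈-toSubset⁻ {v} h = if-inside (P? v) (trans (sym (lookup∘tabulate _ v)) ([]=⇒lookup h))
    where
    if-inside : ∀ {A : Set} (a? : Dec A) → (if does a? then inside else outside) ≡ inside → A
    if-inside (yes a) _ = a
    if-inside (no _) ()

∣p∪q∣≤∣p∣+∣q∣ : ∀ {n} (p q : Subset n) → ∣ p ∪ q ∣ ≤ ∣ p ∣ + ∣ q ∣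
∣p∪q∣≤∣p∣+∣q∣ Vec.[]             Vec.[]             = z≤n
∣p∪q∣≤∣p∣+∣q∣ (inside  Vec.∷ p) (inside  Vec.∷ q) =
  s≤s (≤-trans (∣p∪q∣≤∣p∣+∣q∣ p q) (≤-trans (n≤1+n _) (≤-reflexive (sym (+-suc ∣ p ∣ ∣ q ∣)))))
∣p∪q∣≤∣p∣+∣q∣ (inside  Vec.∷ p) (outside Vec.∷ q) = s≤s (∣p∪q∣≤∣p∣+∣q∣ p q)
∣p∪q∣≤∣p∣+∣q∣ (outside Vec.∷ p) (inside  Vec.∷ q) =
  ≤-trans (s≤s (∣p∪q∣≤∣p∣+∣q∣ p q)) (≤-reflexive (sym (+-suc ∣ p ∣ ∣ q ∣)))
∣p∪q∣≤∣p∣+∣q∣ (outside Vec.∷ p) (outside Vec.∷ q) = ∣p∪q∣≤∣p∣+∣q∣ p q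

module _ {n : ℕ} where

  ∈⋃⁺ : ∀ {v} {xs : List (Subset n)} → Any (v ∈_) xs → v ∈ ⋃ xs
  ∈⋃⁺ (here h)  = x∈p∪q⁺ (inj₁ h)
  ∈⋃⁺ (there h) = x∈p∪q⁺ (inj₂ (∈⋃⁺ h))

  ∈⋃⁻ : ∀ {v} (xs : List (Subset n)) → v ∈ ⋃ xs → Any (v ∈_) xs
  ∈⋃⁻ []       h = contradiction h ∉⊥
  ∈⋃⁻ (p ∷ ps) h with x∈p∪q⁻ p (⋃ ps) h
  ... | inj₁ h′ = here h′
  ... | inj₂ h′ = there (∈⋃⁻ ps h′)

  ∣⋃∣≤ : ∀ {c} {xs : List (Subset n)} → All (λ p → ∣ p ∣ ≤ c) xs → ∣ ⋃ xs ∣ ≤ length xs * c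
  ∣⋃∣≤ All.[]                     = ≤-reflexive (∣⊥∣≡0 n)
  ∣⋃∣≤ {xs = p ∷ ps} (h All.∷ hs) = ≤-trans (∣p∪q∣≤∣p∣+∣q∣ p (⋃ ps)) (+-mono-≤ h (∣⋃∣≤ hs))

  covered-size≤ : ∀ {k c} (q : Fin k → Subset n) {p : Subset n} → (∀ i → ∣ q i ∣ ≤ c) →
                  (∀ {v} → v ∈ p → ∃ λ i → v ∈ q i) → ∣ p ∣ ≤ k * c
  covered-size≤ {k} {c} q {p} bound covered = begin
    ∣ p ∣                   ≤⟨ p⊆q⇒∣p∣≤∣q∣ (λ h → let i , h′ = covered h in ∈⋃⁺ (Anyₚ.tabulate⁺ i h′)) ⟩
    ∣ ⋃ (tabulate q) ∣      ≤⟨ ∣⋃∣≤ (Allₚ.tabulate⁺ bound) ⟩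
    length (tabulate q) * c ≡⟨ cong (_* c) (length-tabulate q) ⟩
    k * c                   ∎
    where open ≤-Reasoning

indicator : ∀ {A : Set} → Dec A → ℕ
indicator (yes _) = 1
indicator (no _)  = 0

∣toSubset∣≡∑ : ∀ {n} {P : Fin n → Set} (P? : Decidable P) → ∣ toSubset P? ∣ ≡ ∑[ v < n ] indicator (P? v)
∣toSubset∣≡∑ {zero}  P? = refl
∣toSubset∣≡∑ {suc n} P? with P? zero
... | yes _ = cong suc (∣toSubset∣≡∑ (P? ∘ suc))
... | no _  = ∣toSubset∣≡∑ (P? ∘ suc)

∑-bound : ∀ {k c} (f : Fin k → ℕ) → (∀ i → f i ≤ c) → ∑[ i < k ] f i ≤ k * c
∑-bound {zero}  f _     = z≤n
∑-bound {suc k} f bound = +-mono-≤ (bound zero) (∑-bound (f ∘ suc) (bound ∘ suc))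

∃-≤-mean : ∀ {t} (f : Fin (suc t) → ℕ) → ∃ λ r → suc t * f r ≤ ∑[ i < suc t ] f i
∃-≤-mean {zero}  f = zero , ≤-refl
∃-≤-mean {suc t} f with ∃-≤-mean (f ∘ suc)
... | r , mean with f zero ≤? f (suc r)
...   | yes f₀≤ = zero , +-monoʳ-≤ (f zero) (≤-trans (*-monoʳ-≤ (suc t) f₀≤) mean)
...   | no f₀≰  = suc r , +-mono-≤ (<⇒≤ (≰⇒> f₀≰)) mean

∑-indicator-unique : ∀ {k} {P : Fin k → Set} (P? : Decidable P) → (∀ {r r′} → P r → P r′ → r ≡ r′) →
                     ∑[ r < k ] indicator (P? r) ≤ 1
∑-indicator-unique {zero}  P? unique = z≤n
∑-indicator-unique {suc k} P? unique with P? zero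
... | yes p = s≤s (≤-reflexive (trans (sum-cong-≗ none) (sum-replicate-zero k)))
  where
  none : ∀ r → indicator (P? (suc r)) ≡ 0
  none r with P? (suc r)
  ... | yes q = contradiction (unique p q) 0≢1+n
  ... | no _  = refl
... | no _  = ∑-indicator-unique (P? ∘ suc) (λ p q → suc-injective (unique p q))

∃-small-class : ∀ {n t} (P : Fin (suc t) → Fin n → Set) (P? : ∀ r → Decidable (P r)) →
                (∀ {r r′ v} → P r v → P r′ v → r ≡ r′) → ∃ λ r → suc t * ∣ toSubset (P? r) ∣ ≤ n
∃-small-class {n} {t} P P? unique
  with r , mean ← ∃-≤-mean (λ r → ∣ toSubset (P? r) ∣) = r , ≤-trans mean total
  where
  open ≤-Reasoning
  total : ∑[ r < suc t ] ∣ toSubset (P? r) ∣ ≤ n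
  total = begin
    ∑[ r < suc t ] ∣ toSubset (P? r) ∣             ≡⟨ sum-cong-≗ (λ r → ∣toSubset∣≡∑ (P? r)) ⟩
    ∑[ r < suc t ] ∑[ v < n ] indicator (P? r v)   ≡⟨ ∑-comm (λ r v → indicator (P? r v)) ⟩
    ∑[ v < n ] ∑[ r < suc t ] indicator (P? r v)   ≤⟨ ∑-bound _ (λ v → ∑-indicator-unique (λ r → P? r v) unique) ⟩
    n * 1                                          ≡⟨ *-identityʳ n ⟩
    n                                              ∎

-- Arithmetic

residues-apart : ∀ x {s r r′} .{{_ : NonZero s}} → r < r′ → r′ < s → (x + r) % s ≡ 0 → (x + r′) % s ≢ 0
residues-apart x {s} {r} {r′} r<r′ r′<s h h′ =
  <⇒≱ (≤-<-trans (m∸n≤m r′ r) r′<s) (∣⇒≤ {{>-nonZero (m<n⇒0<n∸m r<r′)}} s∣gap)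
  where
  split : x + r′ ≡ x + r + (r′ ∸ r)
  split = sym (trans (+-assoc x r _) (cong (x +_) (m+[n∸m]≡n (<⇒≤ r<r′))))
  s∣gap : s ∣ r′ ∸ r
  s∣gap = ∣m+n∣m⇒∣n (subst (s ∣_) split (m%n≡0⇒n∣m _ s h′)) (m%n≡0⇒n∣m _ s h)

residue-unique : ∀ x {s r r′} .{{_ : NonZero s}} → r < s → r′ < s → (x + r) % s ≡ 0 → (x + r′) % s ≡ 0 → r ≡ r′
residue-unique x {r = r} {r′} r<s r′<s h h′ with <-cmp r r′
... | tri< r<r′ _ _ = contradiction h′ (residues-apart x r<r′ r′<s h)
... | tri≈ _ r≡r′ _ = r≡r′
... | tri> _ _ r′<r = contradiction h (residues-apart x r′<r r<s h′)

/-suc : ∀ m t → suc m % suc t ≢ 0 → suc m / suc t ≡ m / suc t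
/-suc m zero    h = contradiction (n%1≡0 (suc m)) h
/-suc m (suc t) h = trans (+-distrib-/ 1 m no-carry) (cong (_+ m / s) (m<n⇒m/n≡0 {1} {s} (s≤s (s≤s z≤n))))
  where
  s : ℕ
  s = suc (suc t)
  no-carry : suc (m % s) < s
  no-carry = ≤∧≢⇒< (m%n<n m s) (λ e → h (trans (%-distribˡ-+ 1 m s) (trans (cong (_% s) e) (n%n≡0 s))))

window-offset : ∀ l r t → (l + r) % suc t ≢ 0 → ∃ λ (i : Fin t) → l ≡ (l + r) / suc t * suc t + suc (toℕ i) ∸ r
window-offset l r t h with (l + r) % suc t in eq
... | zero  = contradiction refl h
... | suc i = fromℕ< i<t , (begin
  l                                                ≡⟨ sym (m+n∸n≡m l r) ⟩
  l + r ∸ r                                        ≡⟨ cong (_∸ r) (m≡m%n+[m/n]*n (l + r) (suc t)) ⟩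
  (l + r) % suc t + q * suc t ∸ r                  ≡⟨ cong (λ ρ → ρ + q * suc t ∸ r) eq ⟩
  suc i + q * suc t ∸ r                            ≡⟨ cong (_∸ r) (+-comm (suc i) _) ⟩
  q * suc t + suc i ∸ r                            ≡⟨ cong (λ j → q * suc t + suc j ∸ r) (sym (toℕ-fromℕ< i<t)) ⟩
  q * suc t + suc (toℕ (fromℕ< i<t)) ∸ r           ∎)
  where
  open ≡-Reasoning
  q : ℕ
  q = (l + r) / suc t
  i<t : i < t
  i<t = ≤-pred (subst (_< suc t) eq (m%n<n (l + r) (suc t)))

least-square-above : ∀ n c N → n ≤ suc N * suc N * c → ∃ λ t → n ≤ suc t * suc t * c × (t ≡ 0 ⊎ t * t * c < n)
least-square-above n c zero    fits = 0 , fits , inj₁ refl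
least-square-above n c (suc N) fits with n ≤? suc N * suc N * c
... | yes fits′ = least-square-above n c N fits′
... | no  ¬fits = suc N , fits , inj₂ (≰⇒> ¬fits)

n≤[1+n]²*c : ∀ n {c} → 1 ≤ c → n ≤ suc n * suc n * c
n≤[1+n]²*c n {c} c≥1 =
  ≤-trans (n≤1+n n) (≤-trans (m≤m*n (suc n) (suc n)) (m≤m*n (suc n * suc n) c {{>-nonZero c≥1}}))

excess-bound : ∀ n c t → n ≤ suc t * suc t * c → t ≡ 0 ⊎ t * t * c < n →
                (suc t * suc t * c ∸ n) + c ≤ 2 * (suc t * c)
excess-bound n c _ fits (inj₁ refl) = begin
  (1 * 1 * c ∸ n) + c ≤⟨ +-monoˡ-≤ c (m∸n≤m _ n) ⟩
  1 * 1 * c + c       ≡⟨ solve (c ∷ []) ⟩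
  2 * (1 * c)         ∎
  where open ≤-Reasoning
excess-bound n c t fits (inj₂ below) = begin
  d + c                 ≤⟨ +-monoˡ-≤ c (<⇒≤ d<) ⟩
  2 * t * c + c + c     ≡⟨ solve (t ∷ c ∷ []) ⟩
  2 * (suc t * c)       ∎
  where
  open ≤-Reasoning
  d : ℕ
  d = suc t * suc t * c ∸ n
  d< : d < 2 * t * c + c
  d< = +-cancelˡ-< (t * t * c) _ _ (begin-strict
    t * t * c + d                <⟨ +-monoˡ-< d below ⟩
    n + d                        ≡⟨ m+[n∸m]≡n fits ⟩
    suc t * suc t * c            ≡⟨ solve (t ∷ c ∷ []) ⟩
    t * t * c + (2 * t * c + c)  ∎)

-- Since a + q + d = 2(n + d), we have a² + 4(n + d)q = 4n(n + d) + (q + d)².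
square-bound : ∀ a q d n M → a + (q + d) ≡ (n + d) + (n + d) → q + d ≤ M → M * M ≤ 4 * (n + d) * q →
               a * a ≤ 4 * n * (n + d)
square-bound a q d n M total K≤M M²≤ = +-cancelʳ-≤ (M * M) _ _ (begin
  a * a + M * M                         ≤⟨ +-monoʳ-≤ (a * a) M²≤ ⟩
  a * a + 4 * (n + d) * q               ≡⟨ +-cancelʳ-≡ (4 * (n + d) * d) _ _ (begin-equality
    a * a + 4 * (n + d) * q + 4 * (n + d) * d
      ≡⟨ solve (a ∷ q ∷ d ∷ n ∷ []) ⟩
    a * a + 2 * ((n + d) + (n + d)) * (q + d)
      ≡⟨ cong (λ x → a * a + 2 * x * (q + d)) (sym total) ⟩
    a * a + 2 * (a + (q + d)) * (q + d)
      ≡⟨ solve (a ∷ q ∷ d ∷ []) ⟩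
    (a + (q + d)) * (a + (q + d)) + (q + d) * (q + d)
      ≡⟨ cong (λ x → x * x + (q + d) * (q + d)) total ⟩
    ((n + d) + (n + d)) * ((n + d) + (n + d)) + (q + d) * (q + d)
      ≡⟨ solve (q ∷ d ∷ n ∷ []) ⟩
    4 * n * (n + d) + (q + d) * (q + d) + 4 * (n + d) * d ∎) ⟩
  4 * n * (n + d) + (q + d) * (q + d)   ≤⟨ +-monoʳ-≤ (4 * n * (n + d)) (*-mono-≤ K≤M K≤M) ⟩
  4 * n * (n + d) + M * M               ∎)
  where open ≤-Reasoning

window-square-bound : ∀ n t c d → n + d ≡ suc t * suc t * c → suc t * c + d ≤ c * (3 * t + 2) →
              (n + suc t * t * c) * (n + suc t * t * c) ≤ 4 * n * (n + d)
window-square-bound n t c d n+d≡ K≤M =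
  square-bound (n + suc t * t * c) (suc t * c) d n (c * (3 * t + 2)) total K≤M M²≤
  where
  open ≤-Reasoning
  total : n + suc t * t * c + (suc t * c + d) ≡ (n + d) + (n + d)
  total = begin-equality
    n + suc t * t * c + (suc t * c + d) ≡⟨ solve (n ∷ t ∷ c ∷ d ∷ []) ⟩
    (n + d) + suc t * suc t * c         ≡⟨ cong ((n + d) +_) (sym n+d≡) ⟩
    (n + d) + (n + d)                   ∎
  -- (3t + 2)² + 4t³ + 3t² = 4(t + 1)³
  M²≤ : c * (3 * t + 2) * (c * (3 * t + 2)) ≤ 4 * (n + d) * (suc t * c)
  M²≤ = begin
    c * (3 * t + 2) * (c * (3 * t + 2))
      ≤⟨ m≤m+n _ (c * c * (4 * t * t * t + 3 * t * t)) ⟩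
    c * (3 * t + 2) * (c * (3 * t + 2)) + c * c * (4 * t * t * t + 3 * t * t)
      ≡⟨ solve (t ∷ c ∷ []) ⟩
    4 * (suc t * suc t * c) * (suc t * c)
      ≡⟨ cong (λ S → 4 * S * (suc t * c)) (sym n+d≡) ⟩
    4 * (n + d) * (suc t * c) ∎

window-width-bound : ∀ {n c t z} → n ≤ suc t * suc t * c → t ≡ 0 ⊎ t * t * c < n → suc t * z ≤ n →
                     (z + t * c) * (z + t * c) ≤ 4 * c * n
window-width-bound {n} {c} {t} {z} fits minimal small = *-cancelˡ-≤ (suc t * suc t) (begin
  suc t * suc t * ((z + t * c) * (z + t * c))               ≡⟨ solve (t ∷ z ∷ c ∷ []) ⟩
  (suc t * z + suc t * t * c) * (suc t * z + suc t * t * c) ≤⟨ *-mono-≤ shifted shifted ⟩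
  (n + suc t * t * c) * (n + suc t * t * c)                 ≤⟨ window-square-bound n t c d (m+[n∸m]≡n fits) K≤M ⟩
  4 * n * (n + d)                                           ≡⟨ cong (4 * n *_) (m+[n∸m]≡n fits) ⟩
  4 * n * (suc t * suc t * c)                               ≡⟨ solve (n ∷ t ∷ c ∷ []) ⟩
  suc t * suc t * (4 * c * n)                               ∎)
  where
  open ≤-Reasoning
  d : ℕ
  d = suc t * suc t * c ∸ n
  shifted : suc t * z + suc t * t * c ≤ n + suc t * t * c
  shifted = +-monoˡ-≤ _ small
  K≤M : suc t * c + d ≤ c * (3 * t + 2)
  K≤M = +-cancelʳ-≤ c _ _ (begin
    suc t * c + d + c           ≡⟨ +-assoc (suc t * c) d c ⟩
    suc t * c + (d + c)         ≤⟨ +-monoʳ-≤ (suc t * c) (excess-bound n c t fits minimal) ⟩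
    suc t * c + 2 * (suc t * c) ≡⟨ solve (t ∷ c ∷ []) ⟩
    c * (3 * t + 2) + c         ∎)

pred-square≤ : ∀ b → (b ∸ 1) ^ 2 ≤ b * b
pred-square≤ b = ≤-trans (≤-reflexive (cong ((b ∸ 1) *_) (*-identityʳ (b ∸ 1)))) (*-mono-≤ (m∸n≤m b 1) (m∸n≤m b 1))

-- Decompositions built from a layered tree-decomposition

maxᶠ : ∀ {n} → (Fin n → ℕ) → ℕ
maxᶠ {zero}  f = 0
maxᶠ {suc n} f = f zero ⊔ maxᶠ (f ∘ suc)

≤-maxᶠ : ∀ {n} (f : Fin n → ℕ) v → f v ≤ maxᶠ f
≤-maxᶠ f zero    = m≤m⊔n (f zero) _
≤-maxᶠ f (suc v) = ≤-trans (≤-maxᶠ (f ∘ suc) v) (m≤n⊔m (f zero) _)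

close-cases : ∀ {p q} → p ≤ suc q → q ≤ suc p → p ≡ q ⊎ q ≡ suc p ⊎ p ≡ suc q
close-cases {p} {q} p≤ q≤ with <-cmp p q
... | tri< p<q _ _ = inj₂ (inj₁ (≤-antisym q≤ p<q))
... | tri≈ _ p≡q _ = inj₁ p≡q
... | tri> _ _ q<p = inj₂ (inj₂ (≤-antisym p≤ q<p))

singleBag-treewidth : ∀ {n} {G : Graph n} {U : Subset n} {w} → ∣ U ∣ ≤ suc w → TreewidthAtMost G U w
singleBag-treewidth {U = U} U≤ = D , λ _ → U≤
  where
  point : Tree
  point = record { size = 0 ; parent = λ () ; parent≤ = λ () }
  D : TreeDecomposition _ U
  D = record { tree = point ; bag = λ _ → U ; bag⊆ = λ _ h → h ; cover = λ _ h → zero , h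
             ; edge = λ _ _ hu hv _ → zero , hu , hv ; conn = λ _ h → connectedIn-all (λ _ → h) }

∈-unionBags⁻ : ∀ {n} {G : Graph n} {U : Subset n} (D : TreeDecomposition G U) {k} (f : Fin k → Node (tree D)) {v} →
               v ∈ unionBags D f → ∃ λ i → v ∈ bag D (f i)
∈-unionBags⁻ D {k} f h = Any.satisfied (Anyₚ.map⁻ {xs = allFin k} (∈⋃⁻ _ h))

module LayeredDecomposition {n} {G : Graph n} (D₀ : TreeDecomposition G Sub.⊤) (L : Layering G) {c : ℕ}
  (layered : ∀ x i → ∣ bag D₀ x ∩ layerSet L i ∣ ≤ c) where

  private
    T₀ : Tree
    T₀ = tree D₀
    X : Node T₀ → Subset n
    X = bag D₀
    ly : Fin n → ℕ
    ly = layer L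

  layerOf : Fin n → Fin (suc (maxᶠ ly))
  layerOf v = fromℕ< (s≤s (≤-maxᶠ ly v))

  toℕ-layerOf : ∀ v → toℕ (layerOf v) ≡ ly v
  toℕ-layerOf v = toℕ-fromℕ< _

  module Windows (t r : ℕ) where

    Separator : ℕ → Set
    Separator l = (l + r) % suc t ≡ 0

    separator? : Decidable Separator
    separator? l = (l + r) % suc t ≟ 0

    separator : Subset n
    separator = toSubset (λ v → separator? (ly v))

    window : Fin n → ℕ
    window v = (ly v + r) / suc t

    InWindow : ℕ → Node T₀ → Fin n → Set
    InWindow j x v = ¬ Separator (ly v) × window v ≡ j × v ∈ X x

    inWindow? : ∀ j x → Decidable (InWindow j x)
    inWindow? j x v = ¬? (separator? (ly v)) ×-dec (window v ≟ j ×-dec v ∈? X x)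

    m : ℕ
    m = maxᶠ ly + r

    windowBag : Fin (suc m) → Node T₀ → Subset n
    windowBag j x = separator ∪ toSubset (inWindow? (toℕ j) x)

    windowOf : Fin n → Fin (suc m)
    windowOf v = fromℕ< (s≤s (≤-trans (m/n≤m (ly v + r) (suc t)) (+-monoˡ-≤ r (≤-maxᶠ ly v))))

    ∈-windowBag⁻ : ∀ {v} j x → v ∈ windowBag j x → Separator (ly v) ⊎ InWindow (toℕ j) x v
    ∈-windowBag⁻ j x h with x∈p∪q⁻ separator _ h
    ... | inj₁ h′ = inj₁ (∈-toSubset⁻ (λ v → separator? (ly v)) h′)
    ... | inj₂ h′ = inj₂ (∈-toSubset⁻ (inWindow? (toℕ j) x) h′)

    separator-∈-windowBag : ∀ {v} → Separator (ly v) → ∀ j x → v ∈ windowBag j x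
    separator-∈-windowBag sep j x = x∈p∪q⁺ (inj₁ (∈-toSubset⁺ (λ v → separator? (ly v)) sep))

    ∈-windowBag⁺ : ∀ {v j x} → ¬ Separator (ly v) → window v ≡ toℕ j → v ∈ X x → v ∈ windowBag j x
    ∈-windowBag⁺ {j = j} {x} ¬sep w≡ hx = x∈p∪q⁺ (inj₂ (∈-toSubset⁺ (inWindow? (toℕ j) x) (¬sep , w≡ , hx)))

    toℕ-windowOf : ∀ v → window v ≡ toℕ (windowOf v)
    toℕ-windowOf v = sym (toℕ-fromℕ< _)

    window-edge : ∀ {u v} → Adj G u v → ¬ Separator (ly u) → ¬ Separator (ly v) → window u ≡ window v
    window-edge {u} {v} a ¬sepᵤ ¬sepᵥ with close-cases (proj₁ (layerOk L u v a)) (proj₂ (layerOk L u v a))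
    ... | inj₁ lᵤ≡lᵥ          = cong (λ l → (l + r) / suc t) lᵤ≡lᵥ
    ... | inj₂ (inj₁ lᵥ≡1+lᵤ) = sym (trans (cong (λ l → (l + r) / suc t) lᵥ≡1+lᵤ)
                                           (/-suc (ly u + r) t (subst (λ l → ¬ Separator l) lᵥ≡1+lᵤ ¬sepᵥ)))
    ... | inj₂ (inj₂ lᵤ≡1+lᵥ) = trans (cong (λ l → (l + r) / suc t) lᵤ≡1+lᵥ)
                                      (/-suc (ly v + r) t (subst (λ l → ¬ Separator l) lᵤ≡1+lᵥ ¬sepᵤ))

    separator-sparse : 1 ≤ t → ∀ l → Separator l → ¬ Separator (suc l)
    separator-sparse 1≤t l sep sep′ =
      residues-apart (l + r) {r = 0} {r′ = 1} (s≤s z≤n) (s≤s 1≤t)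
        (subst (λ a → a % suc t ≡ 0) (sym (+-identityʳ (l + r))) sep)
        (subst (λ a → a % suc t ≡ 0) (sym (+-comm (l + r) 1)) sep′)

    windowBag-size : ∀ j x → ∣ windowBag j x ∣ ≤ ∣ separator ∣ + t * c
    windowBag-size j x = ≤-trans (∣p∪q∣≤∣p∣+∣q∣ separator _)
                                 (+-monoʳ-≤ ∣ separator ∣ (covered-size≤ layerSlice (λ i → layered x _) inSlice))
      where
      layerSlice : Fin t → Subset n
      layerSlice i = X x ∩ layerSet L (toℕ j * suc t + suc (toℕ i) ∸ r)
      inSlice : ∀ {v} → v ∈ toSubset (inWindow? (toℕ j) x) → ∃ λ i → v ∈ layerSlice i
      inSlice {v} h with ∈-toSubset⁻ (inWindow? (toℕ j) x) h
      ... | ¬sep , w≡j , hx with i , l≡ ← window-offset (ly v) r t ¬sep =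
        i , x∈p∩q⁺ (hx , ∈-toSubset⁺ (λ v → ly v ≟ _) (subst (λ w → ly v ≡ w * suc t + suc (toℕ i) ∸ r) w≡j l≡))

    windowBag-covers : ∀ v → v ∈ Sub.⊤ → ∃₂ λ j x → v ∈ windowBag j x
    windowBag-covers v _ with separator? (ly v)
    ... | yes sep = zero , zero , separator-∈-windowBag sep zero zero
    ... | no ¬sep = let x , hx = cover D₀ v ∈⊤ in windowOf v , x , ∈-windowBag⁺ ¬sep (toℕ-windowOf v) hx

    windowBag-joins : ∀ u v → u ∈ Sub.⊤ → v ∈ Sub.⊤ → Adj G u v → ∃₂ λ j x → u ∈ windowBag j x × v ∈ windowBag j x
    windowBag-joins u v _ _ a with separator? (ly u) | separator? (ly v)
    ... | yes sepᵤ | yes sepᵥ =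
      zero , zero , separator-∈-windowBag sepᵤ zero zero , separator-∈-windowBag sepᵥ zero zero
    ... | yes sepᵤ | no ¬sepᵥ = let x , hx = cover D₀ v ∈⊤ in
      windowOf v , x , separator-∈-windowBag sepᵤ _ x , ∈-windowBag⁺ ¬sepᵥ (toℕ-windowOf v) hx
    ... | no ¬sepᵤ | yes sepᵥ = let x , hx = cover D₀ u ∈⊤ in
      windowOf u , x , ∈-windowBag⁺ ¬sepᵤ (toℕ-windowOf u) hx , separator-∈-windowBag sepᵥ _ x
    ... | no ¬sepᵤ | no ¬sepᵥ = let x , hxᵤ , hxᵥ = edge D₀ u v ∈⊤ ∈⊤ a in
      windowOf u , x , ∈-windowBag⁺ ¬sepᵤ (toℕ-windowOf u) hxᵤ ,
      ∈-windowBag⁺ ¬sepᵥ (trans (sym (window-edge a ¬sepᵤ ¬sepᵥ)) (toℕ-windowOf u)) hxᵥ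

    windowBag-spans : ∀ v → v ∈ Sub.⊤ → OneCopy T₀ m windowBag v ⊎ CopyRange T₀ m windowBag v
    windowBag-spans v _ with separator? (ly v)
    ... | yes sep = inj₂ (0 , m , λ j x → mk⇔ (λ _ → z≤n , ≤-pred (toℕ<n j)) (λ _ → separator-∈-windowBag sep j x))
    ... | no ¬sep = inj₁ (windowOf v , only , connectedIn-resp inBag inX (conn D₀ v ∈⊤))
      where
      only : ∀ j x → v ∈ windowBag j x → j ≡ windowOf v
      only j x h with ∈-windowBag⁻ j x h
      ... | inj₁ sep          = contradiction sep ¬sep
      ... | inj₂ (_ , w≡ , _) = toℕ-injective (trans (sym w≡) (toℕ-windowOf v))
      inBag : ∀ {x} → v ∈ X x → v ∈ windowBag (windowOf v) x
      inBag = ∈-windowBag⁺ ¬sep (toℕ-windowOf v)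
      inX : ∀ {x} → v ∈ windowBag (windowOf v) x → v ∈ X x
      inX {x} h with ∈-windowBag⁻ (windowOf v) x h
      ... | inj₁ sep          = contradiction sep ¬sep
      ... | inj₂ (_ , _ , hx) = hx

    windowDecomposition : Σ (TreeDecomposition G Sub.⊤) λ D →
                          (∀ z → ∣ bag D z ∣ ≤ ∣ separator ∣ + t * c) ×
                          (∀ z → ∃ λ x → ∀ {v} → v ∈ bag D z → ¬ Separator (ly v) → v ∈ X x)
    windowDecomposition
      with D , shape ← chainDecomposition T₀ m windowBag (λ _ _ _ → ∈⊤)
                                          windowBag-covers windowBag-joins windowBag-spans
      = D , bounded , located
      where
      bounded : ∀ z → ∣ bag D z ∣ ≤ ∣ separator ∣ + t * c
      bounded z with j , x , e ← shape z = subst (λ B → ∣ B ∣ ≤ _) (sym e) (windowBag-size j x)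
      located : ∀ z → ∃ λ x → ∀ {v} → v ∈ bag D z → ¬ Separator (ly v) → v ∈ X x
      located z with j , x , e ← shape z = x , λ h ¬sep → inX (∈-windowBag⁻ j x (subst (_ ∈_) e h)) ¬sep
        where
        inX : ∀ {v} → Separator (ly v) ⊎ InWindow (toℕ j) x v → ¬ Separator (ly v) → v ∈ X x
        inX (inj₁ sep)          ¬sep = contradiction sep ¬sep
        inX (inj₂ (_ , _ , hx)) _    = hx

  module BagUnions (Sep : ℕ → Set) (sep? : Decidable Sep) (sparse : ∀ l → Sep l → ¬ Sep (suc l))
                   {U : Subset n} {k : ℕ} (x : Fin k → Node T₀)
                   (covered : ∀ {v} → v ∈ U → ¬ Sep (ly v) → ∃ λ i → v ∈ X (x i)) where

    SeparatorIn : ℕ → Node T₀ → Fin n → Set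
    SeparatorIn l y v = v ∈ U × Sep (ly v) × ly v ≡ l × v ∈ X y

    NearLayer : ℕ → Fin n → Set
    NearLayer l v = v ∈ U × ¬ Sep (ly v) × ly v ≤ suc l × l ≤ suc (ly v)

    OnLayer : ℕ → Fin n → Set
    OnLayer l v = v ∈ U × ¬ Sep (ly v) × ly v ≡ l

    separatorIn? : ∀ l y → Decidable (SeparatorIn l y)
    separatorIn? l y v = v ∈? U ×-dec (sep? (ly v) ×-dec (ly v ≟ l ×-dec v ∈? X y))

    nearLayer? : ∀ l → Decidable (NearLayer l)
    nearLayer? l v = v ∈? U ×-dec (¬? (sep? (ly v)) ×-dec (ly v ≤? suc l ×-dec l ≤? suc (ly v)))

    onLayer? : ∀ l → Decidable (OnLayer l)
    onLayer? l v = v ∈? U ×-dec (¬? (sep? (ly v)) ×-dec ly v ≟ l)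

    layerBag : Fin (suc (maxᶠ ly)) → Node T₀ → Subset n
    layerBag j y = toSubset (separatorIn? (toℕ j) y) ∪ toSubset (nearLayer? (toℕ j))

    ∈-layerBag⁻ : ∀ {v} j y → v ∈ layerBag j y → SeparatorIn (toℕ j) y v ⊎ NearLayer (toℕ j) v
    ∈-layerBag⁻ j y h with x∈p∪q⁻ (toSubset (separatorIn? (toℕ j) y)) _ h
    ... | inj₁ h′ = inj₁ (∈-toSubset⁻ (separatorIn? (toℕ j) y) h′)
    ... | inj₂ h′ = inj₂ (∈-toSubset⁻ (nearLayer? (toℕ j)) h′)

    near-∈-layerBag : ∀ {v} j → NearLayer (toℕ j) v → ∀ y → v ∈ layerBag j y
    near-∈-layerBag j near y = x∈p∪q⁺ (inj₂ (∈-toSubset⁺ (nearLayer? (toℕ j)) near))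

    near-∈-layerBagOf : ∀ {v} w → NearLayer (ly w) v → ∀ y → v ∈ layerBag (layerOf w) y
    near-∈-layerBagOf w near = near-∈-layerBag (layerOf w) (subst (λ l → NearLayer l _) (sym (toℕ-layerOf w)) near)

    separator-∈-layerBagOf : ∀ {v} w y → SeparatorIn (ly w) y v → v ∈ layerBag (layerOf w) y
    separator-∈-layerBagOf w y sepIn =
      x∈p∪q⁺ (inj₁ (∈-toSubset⁺ (separatorIn? _ y) (subst (λ l → SeparatorIn l y _) (sym (toℕ-layerOf w)) sepIn)))

    near-self : ∀ {v} → v ∈ U → ¬ Sep (ly v) → NearLayer (ly v) v
    near-self hU ¬sep = hU , ¬sep , n≤1+n _ , n≤1+n _

    layerBag⊆U : ∀ j y → layerBag j y ⊆ U
    layerBag⊆U j y h with ∈-layerBag⁻ j y h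
    ... | inj₁ (hU , _) = hU
    ... | inj₂ (hU , _) = hU

    layerBag-covers : ∀ v → v ∈ U → ∃₂ λ j y → v ∈ layerBag j y
    layerBag-covers v hU with sep? (ly v)
    ... | yes sep = let y , hx = cover D₀ v ∈⊤ in layerOf v , y , separator-∈-layerBagOf v y (hU , sep , refl , hx)
    ... | no ¬sep = layerOf v , zero , near-∈-layerBagOf v (near-self hU ¬sep) zero

    private
      mixed-edge : ∀ {u v} → u ∈ U → v ∈ U → Sep (ly u) → ¬ Sep (ly v) → Adj G u v →
                   ∃₂ λ j y → u ∈ layerBag j y × v ∈ layerBag j y
      mixed-edge {u} {v} hu hv sep ¬sep a =
        let y , hx = cover D₀ u ∈⊤
            lᵤ≤ , lᵥ≤ = layerOk L u v a
        in layerOf u , y , separator-∈-layerBagOf u y (hu , sep , refl , hx) ,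
           near-∈-layerBagOf u (hv , ¬sep , lᵥ≤ , lᵤ≤) y

    layerBag-joins : ∀ u v → u ∈ U → v ∈ U → Adj G u v → ∃₂ λ j y → u ∈ layerBag j y × v ∈ layerBag j y
    layerBag-joins u v hu hv a with sep? (ly u) | sep? (ly v)
    ... | yes sepᵤ | no ¬sepᵥ = mixed-edge hu hv sepᵤ ¬sepᵥ a
    ... | no ¬sepᵤ | yes sepᵥ = let j , y , hv′ , hu′ = mixed-edge hv hu sepᵥ ¬sepᵤ (symm G a) in j , y , hu′ , hv′
    ... | no ¬sepᵤ | no ¬sepᵥ =
      layerOf v , zero , near-∈-layerBagOf v (hu , ¬sepᵤ , layerOk L u v a) zero ,
      near-∈-layerBagOf v (near-self hv ¬sepᵥ) zero
    ... | yes sepᵤ | yes sepᵥ with close-cases (proj₁ (layerOk L u v a)) (proj₂ (layerOk L u v a))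
    ...   | inj₁ lᵤ≡lᵥ = let y , hxᵤ , hxᵥ = edge D₀ u v ∈⊤ ∈⊤ a in
      layerOf u , y , separator-∈-layerBagOf u y (hu , sepᵤ , refl , hxᵤ) ,
      separator-∈-layerBagOf u y (hv , sepᵥ , sym lᵤ≡lᵥ , hxᵥ)
    ...   | inj₂ (inj₁ lᵥ≡1+lᵤ) = contradiction (subst Sep lᵥ≡1+lᵤ sepᵥ) (sparse (ly u) sepᵤ)
    ...   | inj₂ (inj₂ lᵤ≡1+lᵥ) = contradiction (subst Sep lᵤ≡1+lᵥ sepᵤ) (sparse (ly v) sepᵥ)

    layerBag-spans : ∀ v → v ∈ U → OneCopy T₀ (maxᶠ ly) layerBag v ⊎ CopyRange T₀ (maxᶠ ly) layerBag v
    layerBag-spans v hU with sep? (ly v)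
    ... | yes sep = inj₁ (layerOf v , only , connectedIn-resp inBag inX (conn D₀ v ∈⊤))
      where
      only : ∀ j y → v ∈ layerBag j y → j ≡ layerOf v
      only j y h with ∈-layerBag⁻ j y h
      ... | inj₁ (_ , _ , l≡ , _) = toℕ-injective (trans (sym l≡) (sym (toℕ-layerOf v)))
      ... | inj₂ (_ , ¬sep , _)   = contradiction sep ¬sep
      inBag : ∀ {y} → v ∈ X y → v ∈ layerBag (layerOf v) y
      inBag {y} hx = separator-∈-layerBagOf v y (hU , sep , refl , hx)
      inX : ∀ {y} → v ∈ layerBag (layerOf v) y → v ∈ X y
      inX {y} h with ∈-layerBag⁻ (layerOf v) y h
      ... | inj₁ (_ , _ , _ , hx) = hx
      ... | inj₂ (_ , ¬sep , _)   = contradiction sep ¬sep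
    ... | no ¬sep = inj₂ (ly v ∸ 1 , suc (ly v) , λ j y → mk⇔ (range j y) (inRange j y))
      where
      range : ∀ j y → v ∈ layerBag j y → ly v ∸ 1 ≤ toℕ j × toℕ j ≤ suc (ly v)
      range j y h with ∈-layerBag⁻ j y h
      ... | inj₁ (_ , sep , _)       = contradiction sep ¬sep
      ... | inj₂ (_ , _ , lᵥ≤ , j≤) = ∸-monoˡ-≤ 1 lᵥ≤ , j≤
      inRange : ∀ j y → ly v ∸ 1 ≤ toℕ j × toℕ j ≤ suc (ly v) → v ∈ layerBag j y
      inRange j y (p , q) = near-∈-layerBag j (hU , ¬sep , ≤-trans (m≤n+m∸n (ly v) 1) (s≤s p) , q) y

    separatorIn-size : ∀ l y → ∣ toSubset (separatorIn? l y) ∣ ≤ c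
    separatorIn-size l y = ≤-trans (p⊆q⇒∣p∣≤∣q∣ inSlice) (layered y l)
      where
      inSlice : toSubset (separatorIn? l y) ⊆ X y ∩ layerSet L l
      inSlice h = let _ , _ , l≡ , hx = ∈-toSubset⁻ (separatorIn? l y) h
                  in x∈p∩q⁺ (hx , ∈-toSubset⁺ (λ v → ly v ≟ l) l≡)

    onLayer-size : ∀ l → ∣ toSubset (onLayer? l) ∣ ≤ k * c
    onLayer-size l = covered-size≤ (λ i → X (x i) ∩ layerSet L l) (λ i → layered (x i) l) inSlice
      where
      inSlice : ∀ {v} → v ∈ toSubset (onLayer? l) → ∃ λ i → v ∈ X (x i) ∩ layerSet L l
      inSlice h with hU , ¬sep , l≡ ← ∈-toSubset⁻ (onLayer? l) h
                 with i , hx ← covered hU ¬sep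
        = i , x∈p∩q⁺ (hx , ∈-toSubset⁺ (λ v → ly v ≟ l) l≡)

    nearLayer-size : ∀ l → ∣ toSubset (nearLayer? l) ∣ ≤ k * c + (k * c + k * c)
    nearLayer-size l = begin
      ∣ toSubset (nearLayer? l) ∣              ≤⟨ p⊆q⇒∣p∣≤∣q∣ ⊆three ⟩
      ∣ on (l ∸ 1) ∪ (on l ∪ on (suc l)) ∣     ≤⟨ ∣p∪q∣≤∣p∣+∣q∣ (on (l ∸ 1)) _ ⟩
      ∣ on (l ∸ 1) ∣ + ∣ on l ∪ on (suc l) ∣   ≤⟨ +-mono-≤ (onLayer-size (l ∸ 1)) (∣p∪q∣≤∣p∣+∣q∣ (on l) _) ⟩
      k * c + (∣ on l ∣ + ∣ on (suc l) ∣)       ≤⟨ +-monoʳ-≤ (k * c) (+-mono-≤ (onLayer-size l) (onLayer-size (suc l))) ⟩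
      k * c + (k * c + k * c)                   ∎
      where
      open ≤-Reasoning
      on : ℕ → Subset n
      on l = toSubset (onLayer? l)
      ⊆three : toSubset (nearLayer? l) ⊆ on (l ∸ 1) ∪ (on l ∪ on (suc l))
      ⊆three h with hU , ¬sep , lᵥ≤ , l≤ ← ∈-toSubset⁻ (nearLayer? l) h | close-cases lᵥ≤ l≤
      ... | inj₁ lᵥ≡l        = x∈p∪q⁺ (inj₂ (x∈p∪q⁺ (inj₁ (∈-toSubset⁺ (onLayer? l) (hU , ¬sep , lᵥ≡l)))))
      ... | inj₂ (inj₁ l≡1+) = x∈p∪q⁺ (inj₁ (∈-toSubset⁺ (onLayer? (l ∸ 1)) (hU , ¬sep , cong (_∸ 1) (sym l≡1+))))
      ... | inj₂ (inj₂ lᵥ≡1+) = x∈p∪q⁺ (inj₂ (x∈p∪q⁺ (inj₂ (∈-toSubset⁺ (onLayer? (suc l)) (hU , ¬sep , lᵥ≡1+)))))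

    layerBag-size : ∀ j y → ∣ layerBag j y ∣ ≤ suc ((3 * k + 1) * c ∸ 1)
    layerBag-size j y = begin
      ∣ layerBag j y ∣                 ≤⟨ ∣p∪q∣≤∣p∣+∣q∣ (toSubset (separatorIn? (toℕ j) y)) _ ⟩
      _                                ≤⟨ +-mono-≤ (separatorIn-size (toℕ j) y) (nearLayer-size (toℕ j)) ⟩
      c + (k * c + (k * c + k * c))    ≡⟨ solve (k ∷ c ∷ []) ⟩
      (3 * k + 1) * c                  ≤⟨ m≤n+m∸n _ 1 ⟩
      suc ((3 * k + 1) * c ∸ 1)        ∎
      where open ≤-Reasoning

    bagUnion-treewidth : TreewidthAtMost G U ((3 * k + 1) * c ∸ 1)
    bagUnion-treewidth
      with D , shape ← chainDecomposition T₀ (maxᶠ ly) layerBag layerBag⊆U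
                                          layerBag-covers layerBag-joins layerBag-spans
      = D , λ z → let j , y , e = shape z in subst (λ B → ∣ B ∣ ≤ _) (sym e) (layerBag-size j y)

  separator-shift-unique : ∀ t {ρ ρ′ : Fin (suc t)} {v} →
    Windows.Separator t (toℕ ρ) (ly v) → Windows.Separator t (toℕ ρ′) (ly v) → ρ ≡ ρ′
  separator-shift-unique t {ρ} {ρ′} {v} h h′ = toℕ-injective (residue-unique (ly v) (toℕ<n ρ) (toℕ<n ρ′) h h′)

  ∃-thin-separator : ∀ t → ∃ λ r → suc t * ∣ Windows.separator t r ∣ ≤ n
  ∃-thin-separator t
    with ρ , thin ← ∃-small-class (λ ρ v → Windows.Separator t (toℕ ρ) (ly v))
                                  (λ ρ v → Windows.separator? t (toℕ ρ) (ly v)) (separator-shift-unique t)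
    = toℕ ρ , thin

  unionBags-treewidth : ∀ t r → n ≤ suc t * suc t * c → (D : TreeDecomposition G Sub.⊤) →
    (∀ z → ∃ λ x → ∀ {v} → v ∈ bag D z → ¬ Windows.Separator t r (ly v) → v ∈ X x) →
    ∀ {k} (f : Fin k → Node (tree D)) → TreewidthAtMost G (unionBags D f) ((3 * k + 1) * c ∸ 1)
  unionBags-treewidth zero r fits D _ {k} f = singleBag-treewidth (begin
    ∣ unionBags D f ∣           ≤⟨ ∣p∣≤n (unionBags D f) ⟩
    n                           ≤⟨ fits ⟩
    1 * 1 * c                   ≡⟨ *-identityˡ c ⟩
    c                           ≤⟨ m≤n+m c (3 * k * c) ⟩
    3 * k * c + c               ≡⟨ solve (k ∷ c ∷ []) ⟩
    (3 * k + 1) * c             ≤⟨ m≤n+m∸n _ 1 ⟩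
    suc ((3 * k + 1) * c ∸ 1)   ∎)
    where open ≤-Reasoning
  unionBags-treewidth (suc t) r _ D located f =
    BagUnions.bagUnion-treewidth Separator separator? (separator-sparse (s≤s z≤n))
                                 (λ i → proj₁ (located (f i))) covered
    where
    open Windows (suc t) r
    covered : ∀ {v} → v ∈ unionBags D f → ¬ Separator (ly v) → ∃ λ i → v ∈ X (proj₁ (located (f i)))
    covered hU ¬sep = let i , h = ∈-unionBags⁻ D f hU in i , proj₂ (located (f i)) h ¬sep

  lowWidthDecomposition : 1 ≤ c → Σ (TreeDecomposition G Sub.⊤) λ D →
    (∀ z → (∣ bag D z ∣ ∸ 1) ^ 2 ≤ 4 * c * n) ×
    (∀ {k} (f : Fin k → Node (tree D)) → TreewidthAtMost G (unionBags D f) ((3 * k + 1) * c ∸ 1))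
  lowWidthDecomposition c≥1
    with t , fits , minimal ← least-square-above n c n (n≤[1+n]²*c n c≥1)
    with r , thin ← ∃-thin-separator t
    with D , bounded , located ← Windows.windowDecomposition t r
    = D , width , unionBags-treewidth t r fits D located
    where
    width : ∀ z → (∣ bag D z ∣ ∸ 1) ^ 2 ≤ 4 * c * n
    width z = begin
      (∣ bag D z ∣ ∸ 1) ^ 2      ≤⟨ pred-square≤ ∣ bag D z ∣ ⟩
      ∣ bag D z ∣ * ∣ bag D z ∣  ≤⟨ *-mono-≤ (bounded z) (bounded z) ⟩
      (∣ Windows.separator t r ∣ + t * c) * (∣ Windows.separator t r ∣ + t * c)
                                 ≤⟨ window-width-bound fits minimal thin ⟩
      4 * c * n                  ∎
      where open ≤-Reasoning

lemma30 : ∀ {n : ℕ} (G : Graph n) (c : ℕ) → 1 ≤ c → LayeredTWIs G c →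
    Σ (TreeDecomposition G Sub.⊤) λ D →
      (∀ x → (∣ bag D x ∣ ∸ 1) ^ 2 ≤ 4 * c * n) ×
      (∀ (k : ℕ) → 1 ≤ k → (f : Fin k → Node (tree D)) → Injective _≡_ _≡_ f →
        TreewidthAtMost G (unionBags D f) ((3 * k + 1) * c ∸ 1))
-- Only ltw(G) ≤ c is used.
lemma30 G c c≥1 ((D₀ , L , layered) , _) =
  let D , width , unions = LayeredDecomposition.lowWidthDecomposition D₀ L layered c≥1
  in  D , width , λ _ _ f _ → unions f
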